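{- Let $t,\Delta,\omega\ge 2$ be integers and write $\Delta=a(\omega-1)+b$ with integers $a\ge 0$ and $0\le b<\omega-1$. Then \[ f_t(\Delta,\omega)\ \ge\ \rho_t\big(T_\omega(\Delta+a)\big)=\frac{1}{a\omega+b}\sum_{k=0}^{b}\binom{b}{k}\binom{\omega-b}{t-k}(a+1)^k a^{t-k}. \]
   Context: All graphs are finite and simple. For integers $\Delta,\omega$, let $\mathcal{G}(\Delta,\omega)$ be the class of graphs $G$ with maximum degree $\Delta(G)\le\Delta$ and clique number $\omega(G)\le\omega$. For a graph $G$, $k_t(G)$ denotes the number of copies of $K_t$ in $G$, and $\rho_t(G)=k_t(G)/|V(G)|$. For a positive integer $n$ let $k_t(n,\Delta,\omega)=\max\{k_t(G): |V(G)|=n,\ G\in\mathcal{G}(\Delta,\omega)\}$, and define $f_t(\Delta,\omega)=\lim_{n\to\infty}k_t(n,\Delta,\omega)/n$ (this limit exists and equals $\sup_{n}k_t(n,\Delta,\omega)/n$). $T_r(n)$ denotes the Turán graph: the complete $r$-partite graph on $n$ vertices whose part sizes differ by at most one. Binomial coefficients $\binom{m}{j}$ are $0$ when $j<0$ or $j>m$. -}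

module Defs where

open import Data.Bool using (Bool; true; false; not; _∧_; _∨_; if_then_else_)
open import Data.Nat using (ℕ; zero; suc; _+_; _*_; _∸_; _^_; _≤_; _<_; _≡ᵇ_; _≤ᵇ_; _%_)
open import Data.Nat.Combinatorics using (_C_)
open import Data.Fin using (Fin; toℕ)
open import Data.Fin.Subset using (Subset; inside; outside; ∣_∣)
open import Data.Vec using (Vec; []; _∷_; lookup)
open import Data.List using (List; []; _∷_; _++_; map)
open import Data.Integer using (+_)
open import Data.Rational using (ℚ; _/_; 0ℚ)
open import Relation.Binary.PropositionalEquality using (_≡_)

countF : {n : ℕ} → (Fin n → Bool) → ℕ
countF {zero} f = 0
countF {suc n} f = (if f Fin.zero then 1 else 0) + countF (λ i → f (Fin.suc i))

allF : {n : ℕ} → (Fin n → Bool) → Bool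
allF {zero} f = true
allF {suc n} f = f Fin.zero ∧ allF (λ i → f (Fin.suc i))

countL : {A : Set} → (A → Bool) → List A → ℕ
countL p [] = 0
countL p (x ∷ xs) = (if p x then 1 else 0) + countL p xs

allSubsets : (n : ℕ) → List (Subset n)
allSubsets zero = [] ∷ []
allSubsets (suc n) = map (inside ∷_) (allSubsets n) ++ map (outside ∷_) (allSubsets n)

record Graph (n : ℕ) : Set where
  field
    adj   : Fin n → Fin n → Bool
    sym   : ∀ i j → adj i j ≡ adj j i
    irr   : ∀ i → adj i i ≡ false
open Graph public

degree : {n : ℕ} → Graph n → Fin n → ℕ
degree G i = countF (adj G i)

isClique : {n : ℕ} → Graph n → Subset n → Bool
isClique G S = allF (λ i → allF (λ j →
  not (lookup S i ∧ lookup S j) ∨ (toℕ i ≡ᵇ toℕ j) ∨ adj G i j))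

kt : (t : ℕ) → {n : ℕ} → Graph n → ℕ
kt t {n} G = countL (λ S → (∣ S ∣ ≡ᵇ t) ∧ isClique G S) (allSubsets n)

InClass : (Δ ω : ℕ) → {n : ℕ} → Graph n → Set
InClass Δ ω {n} G =
  (∀ (i : Fin n) → degree G i ≤ Δ) ×' (∀ (S : Subset n) → isClique G S ≡ true → ∣ S ∣ ≤ ω)
  where
  open import Data.Product using () renaming (_×_ to _×'_)

-- m / d as a rational; value 0 when d = 0 (never used with d = 0 below)
frac : ℕ → ℕ → ℚ
frac m zero = 0ℚ
frac m (suc d) = (+ m) / suc d

ρ : (t : ℕ) → {n : ℕ} → Graph n → ℚ
ρ t {n} G = frac (kt t G) n

-- Turán graph T_r(n): vertex i lies in part (i mod r); parts have sizes
-- differing by at most one; distinct parts are completely joined.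
part : (r : ℕ) → {n : ℕ} → Fin n → ℕ
part zero i = 0
part (suc r) i = toℕ i % suc r

turan : (r n : ℕ) → Graph n
turan r n = record
  { adj = λ i j → not (part r i ≡ᵇ part r j)
  ; sym = λ i j → symlem (part r i) (part r j)
  ; irr = λ i → irrlem (part r i)
  }
  where
  open import Data.Nat.Properties using (≡ᵇ⇒≡; ≡⇒≡ᵇ)
  symlem : ∀ x y → not (x ≡ᵇ y) ≡ not (y ≡ᵇ x)
  symlem zero zero = _≡_.refl
  symlem zero (suc y) = _≡_.refl
  symlem (suc x) zero = _≡_.refl
  symlem (suc x) (suc y) = symlem x y
  irrlem : ∀ x → not (x ≡ᵇ x) ≡ false
  irrlem zero = _≡_.refl
  irrlem (suc x) = irrlem x

-- Binomial C(m, j) for an integer j = t - k, i.e. 0 when k > t.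
binomSub : (m t k : ℕ) → ℕ
binomSub m t k = if k ≤ᵇ t then m C (t ∸ k) else 0

sumTerm : (t ω a b k : ℕ) → ℕ
sumTerm t ω a b k = (b C k) * binomSub (ω ∸ b) t k * ((a + 1) ^ k) * (a ^ (t ∸ k))

sumTo : ℕ → (ℕ → ℕ) → ℕ
sumTo zero f = f 0
sumTo (suc m) f = sumTo m f + f (suc m)

formula : (t ω a b : ℕ) → ℚ
formula t ω a b = frac (sumTo b (sumTerm t ω a b)) (a * ω + b)

-- f_t(Δ,ω) ≥ x, where f_t(Δ,ω) = sup_n k_t(n,Δ,ω)/n = sup of ρ_t(G) over
-- graphs G ∈ 𝒢(Δ,ω) with at least one vertex:
-- for every rational ε > 0 some such G has ρ_t(G) ≥ x - ε.
FtAtLeast : (t Δ ω : ℕ) → ℚ → Set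
FtAtLeast t Δ ω x = ∀ (ε : ℚ) → 0ℚ Data.Rational.< ε →
  Σ' ℕ (λ n → Σ' (Graph (suc n)) (λ G → InClass Δ ω G ×'' ((x Data.Rational.- ε) Data.Rational.≤ ρ t G)))
  where
  open import Data.Product using () renaming (Σ to Σ'; _×_ to _×''_)
  import Data.Rational

module Submission where

-- T_ω(aω + b) has b parts of size a + 1 and ω − b parts of size a. A vertex is
-- adjacent to everything outside its part, so its degree is at most
-- (aω + b) − a = Δ, and a clique meets each part at most once; hence T_ω(Δ + a)
-- lies in 𝒢(Δ, ω) and bounds f_t(Δ, ω) from below. Its t-cliques are the t-sets
-- meeting each part at most once, so k_t is the elementary symmetric polynomial
-- e_t of the part sizes; expanding e_t of b copies of a + 1 and ω − b copies of a
-- by the number k of large parts used gives the sum. The count is proved by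
-- induction over the vertices for rainbow sets avoiding a set F of colours: those
-- through the first vertex are the rainbow sets of the others avoiding its colour.

open import Defs hiding (sym)
open import Data.Bool using (Bool; true; false; not; _∧_; _∨_; if_then_else_)
open import Data.Bool.Properties
  using (∧-assoc; ∧-idem; ∧-identityʳ; ∧-zeroʳ; ∨-zeroʳ; ∨-identityʳ; ∧-distribˡ-∨; ∧-idempotentCommutativeMonoid)
open import Data.Nat using (ℕ; zero; suc; _+_; _*_; _∸_; _^_; _≤_; _<_; _≡ᵇ_; _%_; s≤s; z≤n)
open import Data.Nat.Properties
open import Data.Nat.Combinatorics using (_C_; nCk+nC[k+1]≡[n+1]C[k+1]; k>n⇒nCk≡0)
open import Data.Nat.DivMod using (m<n⇒m%n≡m; [m+n]%n≡m%n; m%n<n)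
open import Data.Nat.Tactic.RingSolver using (solve-∀)
open import Data.Fin using (Fin; toℕ) renaming (zero to fz; suc to fs)
open import Data.Fin.Subset using (Subset; inside; outside; ∣_∣)
open import Data.Vec using (_∷_; []; lookup)
open import Data.List using (List; []; _∷_; _++_; map)
open import Data.Product using (_×_; _,_)
open import Data.Sum using (inj₁; inj₂)
open import Data.Rational using (0ℚ) renaming (_≤_ to _≤ℚ_; _<_ to _<ℚ_; _-_ to _-ℚ_)
import Data.Rational.Properties as ℚ
open import Function using (_∘_)
open import Relation.Binary using (tri<; tri≈; tri>)
open import Relation.Nullary using (yes; no; contradiction)
open import Relation.Nullary.Decidable using (dec-true; dec-false)
open import Relation.Binary.PropositionalEquality using (_≡_; _≢_; refl; sym; trans; cong; cong₂; subst)
open Relation.Binary.PropositionalEquality.≡-Reasoning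
import Algebra.Solver.IdempotentCommutativeMonoid as ICM-Solver

private variable n : ℕ

≡ᵇ-sym : ∀ c d → (c ≡ᵇ d) ≡ (d ≡ᵇ c)
≡ᵇ-sym zero    zero    = refl
≡ᵇ-sym zero    (suc d) = refl
≡ᵇ-sym (suc c) zero    = refl
≡ᵇ-sym (suc c) (suc d) = ≡ᵇ-sym c d

not-∧ : ∀ x y → not (x ∧ y) ≡ not x ∨ not y
not-∧ true  y = refl
not-∧ false y = refl

not-∨ : ∀ x y → not (x ∨ y) ≡ not x ∧ not y
not-∨ true  y = refl
not-∨ false y = refl

∧-interchange : ∀ w x y z → (w ∧ x) ∧ (y ∧ z) ≡ (w ∧ y) ∧ (x ∧ z)
∧-interchange false x     y z = refl
∧-interchange true  true  y z = refl
∧-interchange true  false y z = sym (∧-zeroʳ y)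

∧-shuffle : ∀ w x y z → (w ∧ x) ∧ (y ∧ z) ≡ y ∧ (x ∧ (z ∧ w))
∧-shuffle a b c d = let _∧′_ = _⊕_ in
  prove 4 ((w ∧′ x) ∧′ (y ∧′ z)) (y ∧′ (x ∧′ (z ∧′ w))) (a ∷ b ∷ c ∷ d ∷ [])
  where
  open ICM-Solver ∧-idempotentCommutativeMonoid
  w x y z : Expr 4
  w = var fz
  x = var (fs fz)
  y = var (fs (fs fz))
  z = var (fs (fs (fs fz)))

allF-cong : (f g : Fin n → Bool) → (∀ i → f i ≡ g i) → allF f ≡ allF g
allF-cong {zero}  f g f≗g = refl
allF-cong {suc n} f g f≗g = cong₂ _∧_ (f≗g fz) (allF-cong (f ∘ fs) (g ∘ fs) (f≗g ∘ fs))

allF-true : {f : Fin n → Bool} → (∀ i → f i ≡ true) → allF f ≡ true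
allF-true {zero}  f≗true = refl
allF-true {suc n} f≗true rewrite f≗true fz = allF-true (f≗true ∘ fs)

allF-∧ : (f g : Fin n → Bool) → allF (λ i → f i ∧ g i) ≡ allF f ∧ allF g
allF-∧ {zero}  f g = refl
allF-∧ {suc n} f g =
  trans (cong ((f fz ∧ g fz) ∧_) (allF-∧ (f ∘ fs) (g ∘ fs)))
        (∧-interchange (f fz) (g fz) _ _)

countF-cong : {f g : Fin n → Bool} → (∀ i → f i ≡ g i) → countF f ≡ countF g
countF-cong {zero}  f≗g = refl
countF-cong {suc n} f≗g = cong₂ (λ b m → (if b then 1 else 0) + m) (f≗g fz) (countF-cong (f≗g ∘ fs))

countF-not : (f : Fin n → Bool) → countF (not ∘ f) + countF f ≡ n
countF-not {zero}  f = refl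
countF-not {suc n} f with f fz
... | true  = trans (+-suc _ _) (cong suc (countF-not (f ∘ fs)))
... | false = cong suc (countF-not (f ∘ fs))

countBelow : ℕ → (ℕ → Bool) → ℕ
countBelow zero    P = 0
countBelow (suc n) P = (if P 0 then 1 else 0) + countBelow n (P ∘ suc)

countF-toℕ : ∀ n (P : ℕ → Bool) → countF {n} (P ∘ toℕ) ≡ countBelow n P
countF-toℕ zero    P = refl
countF-toℕ (suc n) P = cong ((if P 0 then 1 else 0) +_) (countF-toℕ n (P ∘ suc))

countBelow-+ : ∀ x y (P : ℕ → Bool) → countBelow (x + y) P ≡ countBelow x P + countBelow y (λ k → P (x + k))
countBelow-+ zero    y P = refl
countBelow-+ (suc x) y P =
  trans (cong ((if P 0 then 1 else 0) +_) (countBelow-+ x y (P ∘ suc))) (sym (+-assoc (if P 0 then 1 else 0) _ _))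

countBelow-cong : ∀ x {P Q : ℕ → Bool} → (∀ k → k < x → P k ≡ Q k) → countBelow x P ≡ countBelow x Q
countBelow-cong zero    P≗Q = refl
countBelow-cong (suc x) P≗Q =
  cong₂ (λ b m → (if b then 1 else 0) + m) (P≗Q 0 (s≤s z≤n)) (countBelow-cong x (λ k k<x → P≗Q (suc k) (s≤s k<x)))

countBelow-periodic : ∀ ω a b {P : ℕ → Bool} → (∀ k → P (ω + k) ≡ P k) →
  countBelow (a * ω + b) P ≡ a * countBelow ω P + countBelow b P
countBelow-periodic ω zero    b P-periodic = refl
countBelow-periodic ω (suc a) b {P} P-periodic = begin
  countBelow ((ω + a * ω) + b) P
    ≡⟨ cong (λ x → countBelow x P) (+-assoc ω (a * ω) b) ⟩
  countBelow (ω + (a * ω + b)) P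
    ≡⟨ countBelow-+ ω (a * ω + b) P ⟩
  countBelow ω P + countBelow (a * ω + b) (λ k → P (ω + k))
    ≡⟨ cong (countBelow ω P +_) (countBelow-cong (a * ω + b) λ k _ → P-periodic k) ⟩
  countBelow ω P + countBelow (a * ω + b) P
    ≡⟨ cong (countBelow ω P +_) (countBelow-periodic ω a b P-periodic) ⟩
  countBelow ω P + (a * countBelow ω P + countBelow b P)
    ≡⟨ +-assoc (countBelow ω P) _ _ ⟨
  (countBelow ω P + a * countBelow ω P) + countBelow b P ∎

countBelow-≡ᵇ-outside : ∀ x c → x ≤ c → countBelow x (_≡ᵇ c) ≡ 0
countBelow-≡ᵇ-outside zero    c       x≤c       = refl
countBelow-≡ᵇ-outside (suc x) (suc c) (s≤s x≤c) = countBelow-≡ᵇ-outside x c x≤c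

countBelow-false : ∀ x → countBelow x (λ _ → false) ≡ 0
countBelow-false zero    = refl
countBelow-false (suc x) = countBelow-false x

countBelow-≡ᵇ-inside : ∀ x c → c < x → countBelow x (_≡ᵇ c) ≡ 1
countBelow-≡ᵇ-inside (suc x) zero    _         = cong suc (countBelow-false x)
countBelow-≡ᵇ-inside (suc x) (suc c) (s≤s c<x) = countBelow-≡ᵇ-inside x c c<x

countL-++ : {A : Set} (p : A → Bool) (xs ys : List A) → countL p (xs ++ ys) ≡ countL p xs + countL p ys
countL-++ p []       ys = refl
countL-++ p (x ∷ xs) ys =
  trans (cong ((if p x then 1 else 0) +_) (countL-++ p xs ys)) (sym (+-assoc (if p x then 1 else 0) _ _))

countL-map : {A B : Set} (p : B → Bool) (f : A → B) (xs : List A) → countL p (map f xs) ≡ countL (p ∘ f) xs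
countL-map p f []       = refl
countL-map p f (x ∷ xs) = cong ((if p (f x) then 1 else 0) +_) (countL-map p f xs)

countL-cong : {A : Set} {p q : A → Bool} → (∀ x → p x ≡ q x) → (xs : List A) → countL p xs ≡ countL q xs
countL-cong p≗q []       = refl
countL-cong p≗q (x ∷ xs) = cong₂ (λ b m → (if b then 1 else 0) + m) (p≗q x) (countL-cong p≗q xs)

countL-none : {A : Set} {p : A → Bool} → (∀ x → p x ≡ false) → (xs : List A) → countL p xs ≡ 0
countL-none p≗false []       = refl
countL-none p≗false (x ∷ xs) rewrite p≗false x = countL-none p≗false xs

countL-allSubsets-suc : (p : Subset (suc n) → Bool) →
  countL p (allSubsets (suc n)) ≡ countL (p ∘ (inside ∷_)) (allSubsets n) + countL (p ∘ (outside ∷_)) (allSubsets n)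
countL-allSubsets-suc {n} p = trans
  (countL-++ p (map (inside ∷_) (allSubsets n)) (map (outside ∷_) (allSubsets n)))
  (cong₂ _+_ (countL-map p (inside ∷_) (allSubsets n)) (countL-map p (outside ∷_) (allSubsets n)))

countL-allSubsets-pos : (p : Subset n → Bool) (S : Subset n) → p S ≡ true → 1 ≤ countL p (allSubsets n)
countL-allSubsets-pos {zero}  p []          pS rewrite pS = s≤s z≤n
countL-allSubsets-pos {suc n} p (true ∷ S)  pS rewrite countL-allSubsets-suc p =
  ≤-trans (countL-allSubsets-pos (p ∘ (inside ∷_)) S pS) (m≤m+n _ _)
countL-allSubsets-pos {suc n} p (false ∷ S) pS rewrite countL-allSubsets-suc p =
  ≤-trans (countL-allSubsets-pos (p ∘ (outside ∷_)) S pS) (m≤n+m _ _)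

-- esym m t s = e_t (s 0, …, s (m ∸ 1))
esym : ℕ → ℕ → (ℕ → ℕ) → ℕ
esym m       zero    s = 1
esym zero    (suc t) s = 0
esym (suc m) (suc t) s = esym m (suc t) s + s m * esym m t s

esym-cong : ∀ m t {u v : ℕ → ℕ} → (∀ c → c < m → u c ≡ v c) → esym m t u ≡ esym m t v
esym-cong m       zero    u≗v = refl
esym-cong zero    (suc t) u≗v = refl
esym-cong (suc m) (suc t) {u} {v} u≗v =
  cong₂ (λ x y → x + y) (esym-cong m (suc t) below) (cong₂ _*_ (u≗v m ≤-refl) (esym-cong m t below))
  where
  below : ∀ c → c < m → u c ≡ v c
  below c c<m = u≗v c (m<n⇒m<1+n c<m)

esym-allZero : ∀ m t {s : ℕ → ℕ} → (∀ c → s c ≡ 0) → esym m (suc t) s ≡ 0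
esym-allZero zero    t s≗0 = refl
esym-allZero (suc m) t s≗0 rewrite esym-allZero m t s≗0 | s≗0 m = refl

t>m⇒esym≡0 : ∀ {m t} (s : ℕ → ℕ) → m < t → esym m t s ≡ 0
t>m⇒esym≡0 {zero}  {suc t} s _ = refl
t>m⇒esym≡0 {suc m} {suc t} s (s≤s m<t)
  rewrite t>m⇒esym≡0 s m<t | t>m⇒esym≡0 s (m<n⇒m<1+n m<t) = *-zeroʳ (s m)

esym-dropZero : ∀ m t {s : ℕ → ℕ} → s m ≡ 0 → esym (suc m) t s ≡ esym m t s
esym-dropZero m zero    sm≡0 = refl
esym-dropZero m (suc t) sm≡0 rewrite sm≡0 = +-identityʳ _

esym-increment : ∀ m c {u v w : ℕ → ℕ} → c < m →
  u c ≡ suc (v c) → (∀ d → d ≢ c → u d ≡ v d) →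
  w c ≡ 0 → (∀ d → d ≢ c → w d ≡ v d) →
  ∀ t → esym m (suc t) u ≡ esym m (suc t) v + esym m t w
esym-increment (suc m) c {u} {v} {w} c<1+m uc≡1+vc u≗v wc≡0 w≗v t
  with m<1+n⇒m<n∨m≡n c<1+m
... | inj₂ refl = begin
  esym m (suc t) u + u m * esym m t u
    ≡⟨ cong₂ (λ x y → x + y * esym m t u) (esym-cong m (suc t) u≗v-below) uc≡1+vc ⟩
  esym m (suc t) v + suc (v m) * esym m t u
    ≡⟨ cong (λ x → esym m (suc t) v + suc (v m) * x) (esym-cong m t u≗v-below) ⟩
  esym m (suc t) v + suc (v m) * esym m t v
    ≡⟨ +-*-suc-assoc (esym m (suc t) v) (v m) (esym m t v) ⟩
  esym (suc m) (suc t) v + esym m t v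
    ≡⟨ cong (esym (suc m) (suc t) v +_) (esym-cong m t (λ d d<m → sym (w≗v d (<⇒≢ d<m)))) ⟩
  esym (suc m) (suc t) v + esym m t w
    ≡⟨ cong (esym (suc m) (suc t) v +_) (esym-dropZero m t wc≡0) ⟨
  esym (suc m) (suc t) v + esym (suc m) t w ∎
  where
  u≗v-below : ∀ d → d < m → u d ≡ v d
  u≗v-below d d<m = u≗v d (<⇒≢ d<m)
  +-*-suc-assoc : ∀ x y z → x + suc y * z ≡ (x + y * z) + z
  +-*-suc-assoc = solve-∀
... | inj₁ c<m with t
...   | zero
  rewrite esym-increment m c c<m uc≡1+vc u≗v wc≡0 w≗v zero | u≗v m (>⇒≢ c<m) =
    rearrange (esym m 1 v) (v m)
  where
  rearrange : ∀ x y → (x + 1) + y * 1 ≡ (x + y * 1) + 1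
  rearrange = solve-∀
...   | suc t
  rewrite esym-increment m c c<m uc≡1+vc u≗v wc≡0 w≗v (suc t)
        | esym-increment m c c<m uc≡1+vc u≗v wc≡0 w≗v t
        | u≗v m (>⇒≢ c<m) | w≗v m (>⇒≢ c<m) =
    distribute (esym m (suc (suc t)) v) (esym m (suc t) w) (esym m (suc t) v) (esym m t w) (v m)
  where
  distribute : ∀ x y x′ y′ z → (x + y) + z * (x′ + y′) ≡ (x + z * x′) + (y + z * y′)
  distribute = solve-∀

Colouring : ℕ → Set
Colouring n = Fin n → ℕ

multipartite : Colouring n → Fin n → Fin n → Bool
multipartite col i j = not (col i ≡ᵇ col j)

isCliqueIn : (Fin n → Fin n → Bool) → Subset n → Bool
isCliqueIn A S = allF (λ i → allF (λ j → not (lookup S i ∧ lookup S j) ∨ (toℕ i ≡ᵇ toℕ j) ∨ A i j))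

avoids : Colouring n → (ℕ → Bool) → Subset n → Bool
avoids col F S = allF (λ j → not (lookup S j ∧ F (col j)))

-- S has pairwise distinct colours, none of which lies in F.
rainbow : Colouring n → (ℕ → Bool) → Subset n → Bool
rainbow {zero}  col F []          = true
rainbow {suc n} col F (true ∷ S)  = not (F (col fz)) ∧ rainbow (col ∘ fs) (λ c → F c ∨ (c ≡ᵇ col fz)) S
rainbow {suc n} col F (false ∷ S) = rainbow (col ∘ fs) F S

avoids-∨ : (col : Colouring n) (F G : ℕ → Bool) (S : Subset n) →
  avoids col (λ c → F c ∨ G c) S ≡ avoids col F S ∧ avoids col G S
avoids-∨ col F G S = trans
  (allF-cong _ (λ j → avoid F j ∧ avoid G j) λ j →
    trans (cong not (∧-distribˡ-∨ (lookup S j) (F (col j)) (G (col j))))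
          (not-∨ (lookup S j ∧ F (col j)) (lookup S j ∧ G (col j))))
  (allF-∧ (avoid F) (avoid G))
  where
  avoid : (ℕ → Bool) → Fin _ → Bool
  avoid H j = not (lookup S j ∧ H (col j))

isCliqueIn-outside : (A : Fin (suc n) → Fin (suc n) → Bool) (S : Subset n) →
  isCliqueIn A (false ∷ S) ≡ isCliqueIn (λ i j → A (fs i) (fs j)) S
isCliqueIn-outside {n} A S = cong₂ _∧_
  (allF-true {n} {f = λ _ → true} λ _ → refl)
  (allF-cong _ row λ i → cong (λ x → (not x ∨ A (fs i) fz) ∧ row i) (∧-zeroʳ (lookup S i)))
  where
  row : Fin n → Bool
  row i = allF (λ j → not (lookup S i ∧ lookup S j) ∨ (toℕ i ≡ᵇ toℕ j) ∨ A (fs i) (fs j))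

isCliqueIn-inside : (col : Colouring (suc n)) (S : Subset n) →
  isCliqueIn (multipartite col) (true ∷ S) ≡
  avoids (col ∘ fs) (_≡ᵇ col fz) S ∧ isCliqueIn (multipartite (col ∘ fs)) S
isCliqueIn-inside {n} col S = begin
  N₀ ∧ allF (λ i → column i ∧ row i)   ≡⟨ cong₂ _∧_ firstRow (allF-∧ column row) ⟩
  N ∧ (allF column ∧ allF row)          ≡⟨ cong (λ x → N ∧ (x ∧ allF row)) firstColumn ⟩
  N ∧ (N ∧ allF row)                    ≡⟨ sym (∧-assoc N N _) ⟩
  (N ∧ N) ∧ allF row                    ≡⟨ cong (_∧ allF row) (∧-idem N) ⟩
  N ∧ allF row                          ∎
  where
  c₀ : ℕ
  c₀ = col fz
  s : Fin n → Bool
  s = lookup S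
  N N₀ : Bool
  N = avoids (col ∘ fs) (_≡ᵇ c₀) S
  N₀ = allF (λ j → not (s j) ∨ not (c₀ ≡ᵇ col (fs j)))
  column row : Fin n → Bool
  column i = not (s i ∧ true) ∨ not (col (fs i) ≡ᵇ c₀)
  row i = allF (λ j → not (s i ∧ s j) ∨ (toℕ i ≡ᵇ toℕ j) ∨ multipartite (col ∘ fs) i j)
  firstRow : N₀ ≡ N
  firstRow = allF-cong _ _ λ j →
    trans (cong (λ x → not (s j) ∨ not x) (≡ᵇ-sym c₀ (col (fs j)))) (sym (not-∧ (s j) _))
  firstColumn : allF column ≡ N
  firstColumn = allF-cong _ _ λ i →
    trans (cong (λ x → not x ∨ not (col (fs i) ≡ᵇ c₀)) (∧-identityʳ (s i))) (sym (not-∧ (s i) _))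

avoids-false : (col : Colouring n) (S : Subset n) → avoids col (λ _ → false) S ≡ true
avoids-false col S = allF-true λ j → cong not (∧-zeroʳ (lookup S j))

isCliqueIn∧avoids≡rainbow : (col : Colouring n) (F : ℕ → Bool) (S : Subset n) →
  isCliqueIn (multipartite col) S ∧ avoids col F S ≡ rainbow col F S
isCliqueIn∧avoids≡rainbow {zero}  col F [] = refl
isCliqueIn∧avoids≡rainbow {suc n} col F (true ∷ S) = begin
  isCliqueIn (multipartite col) (true ∷ S) ∧ (not (F c₀) ∧ D)
    ≡⟨ cong (_∧ (not (F c₀) ∧ D)) (isCliqueIn-inside col S) ⟩
  (N ∧ K) ∧ (not (F c₀) ∧ D)
    ≡⟨ ∧-shuffle N K (not (F c₀)) D ⟩
  not (F c₀) ∧ (K ∧ (D ∧ N))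
    ≡⟨ cong (λ x → not (F c₀) ∧ (K ∧ x)) (avoids-∨ col′ F (_≡ᵇ c₀) S) ⟨
  not (F c₀) ∧ (K ∧ avoids col′ F′ S)
    ≡⟨ cong (not (F c₀) ∧_) (isCliqueIn∧avoids≡rainbow col′ F′ S) ⟩
  not (F c₀) ∧ rainbow col′ F′ S ∎
  where
  c₀ : ℕ
  c₀ = col fz
  col′ : Colouring n
  col′ = col ∘ fs
  F′ : ℕ → Bool
  F′ c = F c ∨ (c ≡ᵇ c₀)
  N K D : Bool
  N = avoids col′ (_≡ᵇ c₀) S
  K = isCliqueIn (multipartite col′) S
  D = avoids col′ F S
isCliqueIn∧avoids≡rainbow {suc n} col F (false ∷ S) =
  trans (cong (_∧ avoids (col ∘ fs) F S) (isCliqueIn-outside (multipartite col) S))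
        (isCliqueIn∧avoids≡rainbow (col ∘ fs) F S)

classSize : Colouring n → (ℕ → Bool) → ℕ → ℕ
classSize col F c = if F c then 0 else countF (λ i → col i ≡ᵇ c)

rainbowCount : (n : ℕ) → Colouring n → (ℕ → Bool) → ℕ → ℕ
rainbowCount n col F t = countL (λ S → (∣ S ∣ ≡ᵇ t) ∧ rainbow col F S) (allSubsets n)

module _ (col : Colouring (suc n)) (F : ℕ → Bool) where

  private
    c₀ : ℕ
    c₀ = col fz

  classSize-other : ∀ c → c ≢ c₀ → classSize col F c ≡ classSize (col ∘ fs) F c
  classSize-other c c≢c₀ with F c
  ... | true  = refl
  ... | false rewrite dec-false (c₀ ≟ c) (c≢c₀ ∘ sym) = refl

  classSize-head : F c₀ ≡ false → classSize col F c₀ ≡ suc (classSize (col ∘ fs) F c₀)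
  classSize-head Fc₀≡false rewrite Fc₀≡false | dec-true (c₀ ≟ c₀) refl = refl

  classSize-forbiddenHead : F c₀ ≡ true → ∀ c → classSize col F c ≡ classSize (col ∘ fs) F c
  classSize-forbiddenHead Fc₀≡true c with c ≟ c₀
  ... | yes refl rewrite Fc₀≡true = refl
  ... | no c≢c₀ = classSize-other c c≢c₀

classSize-forbid : (col : Colouring n) (F : ℕ → Bool) (c₀ : ℕ) →
  classSize col (λ c → F c ∨ (c ≡ᵇ c₀)) c₀ ≡ 0
classSize-forbid col F c₀ rewrite dec-true (c₀ ≟ c₀) refl | ∨-zeroʳ (F c₀) = refl

classSize-forbid-other : (col : Colouring n) (F : ℕ → Bool) {c₀ : ℕ} (c : ℕ) → c ≢ c₀ →
  classSize col (λ d → F d ∨ (d ≡ᵇ c₀)) c ≡ classSize col F c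
classSize-forbid-other col F {c₀} c c≢c₀ rewrite dec-false (c ≟ c₀) c≢c₀ | ∨-identityʳ (F c) = refl

rainbowCount≡esym : ∀ m {n} (col : Colouring n) (F : ℕ → Bool) → (∀ i → col i < m) →
  ∀ t → rainbowCount n col F t ≡ esym m t (classSize col F)
rainbowCount≡esym m {zero}  col F col<m zero    = refl
rainbowCount≡esym m {zero}  col F col<m (suc t) = sym (esym-allZero m t emptyClass)
  where
  emptyClass : ∀ c → classSize col F c ≡ 0
  emptyClass c with F c
  ... | true  = refl
  ... | false = refl
rainbowCount≡esym m {suc n} col F col<m t
  rewrite countL-allSubsets-suc (λ S → (∣ S ∣ ≡ᵇ t) ∧ rainbow col F S) with t | F (col fz) in Fc₀
... | zero  | _     = trans
  (cong (_+ rainbowCount n (col ∘ fs) F 0) (countL-none (λ _ → refl) (allSubsets n)))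
  (rainbowCount≡esym m (col ∘ fs) F (col<m ∘ fs) zero)
... | suc t | true  = begin
  countL _ (allSubsets n) + rainbowCount n col′ F (suc t)
    ≡⟨ cong (_+ rainbowCount n col′ F (suc t)) (countL-none (λ _ → ∧-zeroʳ _) (allSubsets n)) ⟩
  rainbowCount n col′ F (suc t)
    ≡⟨ rainbowCount≡esym m col′ F (col<m ∘ fs) (suc t) ⟩
  esym m (suc t) (classSize col′ F)
    ≡⟨ esym-cong m (suc t) (λ c _ → classSize-forbiddenHead col F Fc₀ c) ⟨
  esym m (suc t) (classSize col F) ∎
  where
  col′ : Colouring n
  col′ = col ∘ fs
... | suc t | false = begin
  rainbowCount n col′ F′ t + rainbowCount n col′ F (suc t)
    ≡⟨ cong₂ _+_ (rainbowCount≡esym m col′ F′ (col<m ∘ fs) t) (rainbowCount≡esym m col′ F (col<m ∘ fs) (suc t)) ⟩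
  esym m t (classSize col′ F′) + esym m (suc t) (classSize col′ F)
    ≡⟨ +-comm (esym m t (classSize col′ F′)) _ ⟩
  esym m (suc t) (classSize col′ F) + esym m t (classSize col′ F′)
    ≡⟨ esym-increment m c₀ (col<m fz) (classSize-head col F Fc₀) (classSize-other col F)
         (classSize-forbid col′ F c₀) (classSize-forbid-other col′ F) t ⟨
  esym m (suc t) (classSize col F) ∎
  where
  c₀ : ℕ
  c₀ = col fz
  col′ : Colouring n
  col′ = col ∘ fs
  F′ : ℕ → Bool
  F′ c = F c ∨ (c ≡ᵇ c₀)

sumTo-+ : ∀ m {f g h : ℕ → ℕ} → (∀ k → f k ≡ g k + h k) → sumTo m f ≡ sumTo m g + sumTo m h
sumTo-+ zero    f≗g+h = f≗g+h 0
sumTo-+ (suc m) {f} {g} {h} f≗g+h rewrite sumTo-+ m f≗g+h | f≗g+h (suc m) =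
  interchange (sumTo m g) (sumTo m h) (g (suc m)) (h (suc m))
  where
  interchange : ∀ w x y z → (w + x) + (y + z) ≡ (w + y) + (x + z)
  interchange = solve-∀

sumTo-*ˡ : ∀ m a (h : ℕ → ℕ) → sumTo m (λ k → a * h k) ≡ a * sumTo m h
sumTo-*ˡ zero    a h = refl
sumTo-*ˡ (suc m) a h rewrite sumTo-*ˡ m a h = sym (*-distribˡ-+ a (sumTo m h) (h (suc m)))

sumTo-zero : ∀ m {g : ℕ → ℕ} → (∀ k → k ≤ m → g k ≡ 0) → sumTo m g ≡ 0
sumTo-zero zero    g≗0 = g≗0 0 z≤n
sumTo-zero (suc m) g≗0 rewrite sumTo-zero m (λ k k≤m → g≗0 k (≤-trans k≤m (n≤1+n m))) = g≗0 (suc m) ≤-refl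

sumTo-single : ∀ {m t} {g : ℕ → ℕ} → t ≤ m → (∀ k → k ≢ t → g k ≡ 0) → sumTo m g ≡ g t
sumTo-single {zero}          z≤n g≗0 = refl
sumTo-single {suc m} {t} {g} t≤1+m g≗0 with m≤n⇒m<n∨m≡n t≤1+m
... | inj₁ (s≤s t≤m) rewrite sumTo-single t≤m g≗0 | g≗0 (suc m) (<⇒≢ (s≤s t≤m) ∘ sym) = +-identityʳ (g t)
... | inj₂ refl rewrite sumTo-zero m (λ k k≤m → g≗0 k (<⇒≢ (s≤s k≤m))) = refl

binomSub-≤ : ∀ m {t k} → k ≤ t → binomSub m t k ≡ m C (t ∸ k)
binomSub-≤ m {t} {k} k≤t rewrite dec-true (k ≤? t) k≤t = refl

binomSub-> : ∀ m {t k} → t < k → binomSub m t k ≡ 0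
binomSub-> m {t} {k} t<k rewrite dec-false (k ≤? t) (<⇒≱ t<k) = refl

binomSub-0 : ∀ {t k} → k ≢ t → binomSub 0 t k ≡ 0
binomSub-0 {t} {k} k≢t with <-cmp k t
... | tri< k<t _ _ = trans (binomSub-≤ 0 (<⇒≤ k<t)) (k>n⇒nCk≡0 (m<n⇒0<n∸m k<t))
... | tri≈ _ k≡t _ = contradiction k≡t k≢t
... | tri> _ _ t<k = binomSub-> 0 t<k

-- sumTerm t ω a b is definitionally binomialTerm a b (ω ∸ b) t; keeping the
-- number j = ω ∸ b of small parts as a variable allows induction on it.
binomialTerm : (a b j t k : ℕ) → ℕ
binomialTerm a b j t k = (b C k) * binomSub j t k * (a + 1) ^ k * a ^ (t ∸ k)

binomialTerm-pascal : ∀ a b j t k →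
  binomialTerm a b (suc j) (suc t) k ≡ binomialTerm a b j (suc t) k + a * binomialTerm a b j t k
binomialTerm-pascal a b j t k with <-cmp k (suc t)
... | tri< (s≤s k≤t) _ _
  rewrite binomSub-≤ (suc j) (m≤n⇒m≤1+n k≤t) | binomSub-≤ j (m≤n⇒m≤1+n k≤t) | binomSub-≤ j k≤t
        | +-∸-assoc 1 k≤t | sym (nCk+nC[k+1]≡[n+1]C[k+1] j (t ∸ k)) =
  split (b C k) (j C (t ∸ k)) (j C suc (t ∸ k)) ((a + 1) ^ k) a (a ^ (t ∸ k))
  where
  split : ∀ B X Y P a Q → B * (X + Y) * P * (a * Q) ≡ B * Y * P * (a * Q) + a * (B * X * P * Q)
  split = solve-∀
... | tri≈ _ refl _
  rewrite binomSub-≤ (suc j) (≤-refl {suc t}) | binomSub-≤ j (≤-refl {suc t}) | binomSub-> j (≤-refl {suc t})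
        | n∸n≡0 t =
  vanish (b C suc t) ((a + 1) ^ suc t) a (a ^ (t ∸ suc t))
  where
  vanish : ∀ B P a Q → B * 1 * P * 1 ≡ B * 1 * P * 1 + a * (B * 0 * P * Q)
  vanish = solve-∀
... | tri> _ _ 1+t<k
  rewrite binomSub-> (suc j) 1+t<k | binomSub-> j 1+t<k | binomSub-> j (<⇒≤ 1+t<k) =
  vanish (b C k) ((a + 1) ^ k) a (a ^ (suc t ∸ k)) (a ^ (t ∸ k))
  where
  vanish : ∀ B P a Q Q′ → B * 0 * P * Q ≡ B * 0 * P * Q + a * (B * 0 * P * Q′)
  vanish = solve-∀

esym-const : ∀ {b x} {s : ℕ → ℕ} → (∀ c → c < b → s c ≡ x) → ∀ m t → m ≤ b → esym m t s ≡ (m C t) * x ^ t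
esym-const s≗x m       zero    m≤b = refl
esym-const s≗x zero    (suc t) m≤b = refl
esym-const {x = x} s≗x (suc m) (suc t) m<b
  rewrite esym-const s≗x m (suc t) (<⇒≤ m<b) | esym-const s≗x m t (<⇒≤ m<b) | s≗x m m<b
        | sym (nCk+nC[k+1]≡[n+1]C[k+1] m t) =
  collect (m C suc t) (m C t) x (x ^ t)
  where
  collect : ∀ Y X x P → Y * (x * P) + x * (X * P) ≡ (X + Y) * (x * P)
  collect = solve-∀

binomialTerm-j≡0 : ∀ a b {t k} → k ≢ t → binomialTerm a b 0 t k ≡ 0
binomialTerm-j≡0 a b {t} {k} k≢t rewrite binomSub-0 k≢t | *-zeroʳ (b C k) = refl

sumTo-binomialTerm-j≡0 : ∀ a b t → sumTo b (binomialTerm a b 0 t) ≡ (b C t) * (a + 1) ^ t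
sumTo-binomialTerm-j≡0 a b t with ≤-<-connex t b
... | inj₁ t≤b rewrite sumTo-single t≤b (λ k → binomialTerm-j≡0 a b {t} {k}) | binomSub-≤ 0 (≤-refl {t}) | n∸n≡0 t =
  unit (b C t) ((a + 1) ^ t)
  where
  unit : ∀ B P → B * 1 * P * 1 ≡ B * P
  unit = solve-∀
... | inj₂ b<t rewrite k>n⇒nCk≡0 b<t = sumTo-zero b λ k k≤b → binomialTerm-j≡0 a b (<⇒≢ (≤-<-trans k≤b b<t))

sumTo-binomialTerm-t≡0 : ∀ a b j → sumTo b (binomialTerm a b j 0) ≡ 1
sumTo-binomialTerm-t≡0 a b j = sumTo-single {b} z≤n offDiagonal
  where
  offDiagonal : ∀ k → k ≢ 0 → binomialTerm a b j 0 k ≡ 0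
  offDiagonal zero    k≢0 = contradiction refl k≢0
  offDiagonal (suc k) _   rewrite *-zeroʳ (b C suc k) = refl

esym-twoValued : ∀ a b j {s : ℕ → ℕ} → (∀ c → c < b → s c ≡ a + 1) → (∀ c → b ≤ c → c < b + j → s c ≡ a) →
  ∀ t → esym (b + j) t s ≡ sumTo b (binomialTerm a b j t)
esym-twoValued a b zero    head tail t rewrite +-identityʳ b =
  trans (esym-const head b t ≤-refl) (sym (sumTo-binomialTerm-j≡0 a b t))
esym-twoValued a b (suc j) head tail zero = sym (sumTo-binomialTerm-t≡0 a b (suc j))
esym-twoValued a b (suc j) {s} head tail (suc t) rewrite +-suc b j = begin
  esym (b + j) (suc t) s + s (b + j) * esym (b + j) t s
    ≡⟨ cong₂ (λ x y → x + y * esym (b + j) t s)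
             (esym-twoValued a b j head tail′ (suc t)) (tail (b + j) (m≤m+n b j) ≤-refl) ⟩
  sumTo b (binomialTerm a b j (suc t)) + a * esym (b + j) t s
    ≡⟨ cong (λ x → sumTo b (binomialTerm a b j (suc t)) + a * x) (esym-twoValued a b j head tail′ t) ⟩
  sumTo b (binomialTerm a b j (suc t)) + a * sumTo b (binomialTerm a b j t)
    ≡⟨ cong (sumTo b (binomialTerm a b j (suc t)) +_) (sumTo-*ˡ b a (binomialTerm a b j t)) ⟨
  sumTo b (binomialTerm a b j (suc t)) + sumTo b (λ k → a * binomialTerm a b j t k)
    ≡⟨ sumTo-+ b (binomialTerm-pascal a b j t) ⟨
  sumTo b (binomialTerm a b (suc j) (suc t)) ∎
  where
  tail′ : ∀ c → b ≤ c → c < b + j → s c ≡ a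
  tail′ c b≤c c<b+j = tail c b≤c (≤-trans c<b+j (n≤1+n _))

isClique-turan : ∀ r {n} (S : Subset n) → isClique (turan r n) S ≡ rainbow (part r) (λ _ → false) S
isClique-turan r S = begin
  isClique (turan r _) S                                       ≡⟨ ∧-identityʳ _ ⟨
  isClique (turan r _) S ∧ true                                ≡⟨ cong (isClique (turan r _) S ∧_) (avoids-false (part r) S) ⟨
  isClique (turan r _) S ∧ avoids (part r) (λ _ → false) S     ≡⟨ isCliqueIn∧avoids≡rainbow (part r) (λ _ → false) S ⟩
  rainbow (part r) (λ _ → false) S                             ∎

kt-turan : ∀ r n t → kt t (turan r n) ≡ rainbowCount n (part r) (λ _ → false) t
kt-turan r n t = countL-cong (λ S → cong ((∣ S ∣ ≡ᵇ t) ∧_) (isClique-turan r S)) (allSubsets n)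

part<ω : ∀ r {n} (i : Fin n) → part (suc r) i < suc r
part<ω r i = m%n<n (toℕ i) (suc r)

turan-cliqueBound : ∀ r {n} (S : Subset n) → isClique (turan (suc r) n) S ≡ true → ∣ S ∣ ≤ suc r
turan-cliqueBound r {n} S S-clique with ∣ S ∣ ≤? suc r
... | yes |S|≤ω = |S|≤ω
... | no  |S|≰ω = contradiction (≤-trans rainbowS (≤-reflexive noRainbow)) λ ()
  where
  rainbowS : 1 ≤ rainbowCount n (part (suc r)) (λ _ → false) ∣ S ∣
  rainbowS = countL-allSubsets-pos {n} _ S
    (cong₂ _∧_ (dec-true (∣ S ∣ ≟ ∣ S ∣) refl) (trans (sym (isClique-turan (suc r) S)) S-clique))
  noRainbow : rainbowCount n (part (suc r)) (λ _ → false) ∣ S ∣ ≡ 0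
  noRainbow = trans (rainbowCount≡esym (suc r) {n} (part (suc r)) (λ _ → false) (part<ω r) ∣ S ∣)
                    (t>m⇒esym≡0 _ (≰⇒> |S|≰ω))

part-classSize : ∀ r a b {n} → n ≡ a * suc r + b → b ≤ suc r →
  ∀ c → c < suc r → classSize (part (suc r) {n}) (λ _ → false) c ≡ a + countBelow b (_≡ᵇ c)
part-classSize r a b {n} refl b≤ω c c<ω = begin
  countF {n} (P ∘ toℕ)
    ≡⟨ countF-toℕ n P ⟩
  countBelow (a * ω + b) P
    ≡⟨ countBelow-periodic ω a b P-periodic ⟩
  a * countBelow ω P + countBelow b P
    ≡⟨ cong₂ (λ x y → a * x + y) (trans (countBelow-cong ω P≗≡ᵇc) (countBelow-≡ᵇ-inside ω c c<ω))
                                 (countBelow-cong b λ k k<b → P≗≡ᵇc k (≤-trans k<b b≤ω)) ⟩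
  a * 1 + countBelow b (_≡ᵇ c)
    ≡⟨ cong (_+ countBelow b (_≡ᵇ c)) (*-identityʳ a) ⟩
  a + countBelow b (_≡ᵇ c) ∎
  where
  ω : ℕ
  ω = suc r
  P : ℕ → Bool
  P k = k % ω ≡ᵇ c
  P-periodic : ∀ k → P (ω + k) ≡ P k
  P-periodic k = cong (_≡ᵇ c) (trans (cong (_% ω) (+-comm ω k)) ([m+n]%n≡m%n k ω))
  P≗≡ᵇc : ∀ k → k < ω → P k ≡ (k ≡ᵇ c)
  P≗≡ᵇc k k<ω = cong (_≡ᵇ c) (m<n⇒m%n≡m k<ω)

kt-turan-closedForm : ∀ r a b {n} → n ≡ a * suc r + b → b ≤ suc r →
  ∀ t → kt t (turan (suc r) n) ≡ sumTo b (sumTerm t (suc r) a b)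
kt-turan-closedForm r a b {n} n≡aω+b b≤ω t = begin
  kt t (turan ω n)                           ≡⟨ kt-turan ω n t ⟩
  rainbowCount n (part ω) (λ _ → false) t    ≡⟨ rainbowCount≡esym ω {n} (part ω) (λ _ → false) (part<ω r) t ⟩
  esym ω t s                                 ≡⟨ cong (λ m → esym m t s) (m+[n∸m]≡n b≤ω) ⟨
  esym (b + (ω ∸ b)) t s                     ≡⟨ esym-twoValued a b (ω ∸ b) large small t ⟩
  sumTo b (binomialTerm a b (ω ∸ b) t)       ∎
  where
  ω : ℕ
  ω = suc r
  s : ℕ → ℕ
  s = classSize (part ω {n}) (λ _ → false)
  large : ∀ c → c < b → s c ≡ a + 1
  large c c<b = trans (part-classSize r a b n≡aω+b b≤ω c (≤-trans c<b b≤ω)) (cong (a +_) (countBelow-≡ᵇ-inside b c c<b))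
  small : ∀ c → b ≤ c → c < b + (ω ∸ b) → s c ≡ a
  small c b≤c c<ω rewrite m+[n∸m]≡n b≤ω =
    trans (part-classSize r a b n≡aω+b b≤ω c c<ω) (trans (cong (a +_) (countBelow-≡ᵇ-outside b c b≤c)) (+-identityʳ a))

degree+classSize : ∀ r {n} (i : Fin n) →
  degree (turan r n) i + classSize (part r {n}) (λ _ → false) (part r i) ≡ n
degree+classSize r {n} i = trans
  (cong (degree (turan r n) i +_) (countF-cong {n} λ j → ≡ᵇ-sym (part r j) (part r i)))
  (countF-not (λ j → part r i ≡ᵇ part r j))

turan-maxDegree : ∀ r a b {Δ} → Δ + a ≡ a * suc r + b → b ≤ suc r → ∀ i → degree (turan (suc r) (Δ + a)) i ≤ Δ
turan-maxDegree r a b {Δ} n≡aω+b b≤ω i = +-cancelʳ-≤ a (degree G i) Δ (≤-trans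
  (+-monoʳ-≤ (degree G i) (m≤m+n a (countBelow b (_≡ᵇ c))))
  (≤-reflexive (trans (cong (degree G i +_) (sym (part-classSize r a b n≡aω+b b≤ω c (part<ω r i))))
                      (degree+classSize (suc r) i))))
  where
  G : Graph (Δ + a)
  G = turan (suc r) (Δ + a)
  c : ℕ
  c = part (suc r) i

turan-inClass : ∀ r a b {Δ} → Δ + a ≡ a * suc r + b → b ≤ suc r → InClass Δ (suc r) (turan (suc r) (Δ + a))
turan-inClass r a b n≡aω+b b≤ω = turan-maxDegree r a b n≡aω+b b≤ω , turan-cliqueBound r

p-ε≤p : ∀ p {ε} → 0ℚ <ℚ ε → p -ℚ ε ≤ℚ p
p-ε≤p p ε>0 = subst (p -ℚ _ ≤ℚ_) (ℚ.+-identityʳ p) (ℚ.+-monoʳ-≤ p (ℚ.neg-antimono-≤ (ℚ.<⇒≤ ε>0)))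

FtAtLeast-member : ∀ t {Δ ω n} (G : Graph (suc n)) → InClass Δ ω G → FtAtLeast t Δ ω (ρ t G)
FtAtLeast-member t {n = n} G G∈𝒢 ε ε>0 = n , G , G∈𝒢 , p-ε≤p (ρ t G) ε>0

lemma3p3 : (t Δ ω a b : ℕ) → 2 ≤ t → 2 ≤ Δ → 2 ≤ ω →
    Δ ≡ a * (ω ∸ 1) + b → b < ω ∸ 1 →
    FtAtLeast t Δ ω (ρ t (turan ω (Δ + a))) × (ρ t (turan ω (Δ + a)) ≡ formula t ω a b)
lemma3p3 t (suc Δ) (suc r) a b _ _ _ Δ≡ar+b b<r =
  FtAtLeast-member t (turan (suc r) (suc Δ + a)) (turan-inClass r a b n≡aω+b b≤ω) ,
  cong₂ frac (kt-turan-closedForm r a b n≡aω+b b≤ω t) n≡aω+b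
  where
  b≤ω : b ≤ suc r
  b≤ω = ≤-trans (n≤1+n b) (m≤n⇒m≤1+n b<r)
  n≡aω+b : suc Δ + a ≡ a * suc r + b
  n≡aω+b = trans (cong (_+ a) Δ≡ar+b) (shift a r b)
    where
    shift : ∀ a r b → a * r + b + a ≡ a * suc r + b
    shift = solve-∀
lemma3p3 t zero    ω       a b _ () _ _ _
lemma3p3 t (suc Δ) zero    a b _ _ () _ _
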